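{- Let $n\geq 7$ and let $i,j\in\{0,1\}$. Then the path $v_1,v_2,\dots,v_n$ admits a $3$-rs colouring $f$ with $f(v_1)=i$ and $f(v_n)=j$.
   Context: A $3$-restricted star colouring ($3$-rs colouring) of a graph $G$ is a map $f:V(G)\to\{0,1,2\}$ with $f(x)\neq f(y)$ for every edge $xy$ and with no path $x,y,z$ in $G$ such that $f(y)>f(x)=f(z)$. -}

module Defs where

open import Data.Nat using (ℕ; suc; _<_)
open import Data.Fin using (Fin; toℕ)
open import Data.Product using (_×_)
open import Data.Sum using (_⊎_)
open import Data.Empty using (⊥)
open import Relation.Binary.PropositionalEquality using (_≡_; _≢_)

record Graph (n : ℕ) : Set₁ where
  field
    Adj : Fin n → Fin n → Set

open Graph public

-- The path v₁,v₂,…,vₙ: vertex vₖ is represented by Fin index k-1;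
-- vertices x,y are adjacent iff their indices differ by exactly one.
Path : (n : ℕ) → Graph n
Path n = record { Adj = λ x y → (suc (toℕ x) ≡ toℕ y) ⊎ (suc (toℕ y) ≡ toℕ x) }

Is3rsColouring : {n : ℕ} → Graph n → (Fin n → Fin 3) → Set
Is3rsColouring {n} G f =
  (∀ (x y : Fin n) → Adj G x y → f x ≢ f y)
  × (∀ (x y z : Fin n) → Adj G x y → Adj G y z → x ≢ z →
       f x ≡ f z → toℕ (f x) < toℕ (f y) → ⊥)

-- A 3-rs colouring of a path is a word over {0,1,2} with distinct neighbours and
-- no factor a b a with a < b. Since 0 is the least colour it is never the top of
-- such a peak, so a nonzero colour may always be put in front of a 0, and in
-- particular the block 0 1 2 may be put in front of any word starting with 0.
-- Pumping six explicit words of lengths 7, 8, 9 starting with 0 gives every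
-- length; a leading 1 is put in front of a word one shorter, except in length 7,
-- where no rs-word 0 … 0 of length 6 exists and two words are given explicitly.
module Submission where

open import Defs
open import Data.Nat using (ℕ; suc; _≤_; _∸_; _+_; _<_; _<?_)
open import Data.Nat.Properties using (suc-injective; m≤n⇒∃[o]m+o≡n)
open import Data.Fin using (Fin; toℕ; inject₁; fromℕ; zero; suc; _≟_)
open import Data.Fin.Patterns using (0F; 1F; 2F)
open import Data.Fin.Properties using (toℕ-injective; toℕ-fromℕ)
open import Data.Vec using (Vec; []; _∷_; lookup)
open import Data.Product using (Σ; _×_; _,_)
open import Data.Sum using (inj₁; inj₂)
open import Data.Unit using (⊤; tt)
open import Data.Empty using (⊥)
open import Relation.Nullary using (¬_; Dec; yes)
open import Relation.Nullary.Decidable using (¬?; _×-dec_; from-yes)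
open import Relation.Binary.PropositionalEquality using (_≡_; _≢_; refl; sym; trans; cong; subst)

Colour : Set
Colour = Fin 3

Peak : Colour → Colour → Colour → Set
Peak a b c = a ≡ c × toℕ a < toℕ b

Peak-sym : ∀ {a b c} → Peak a b c → Peak c b a
Peak-sym {b = b} (a≡c , a<b) = sym a≡c , subst (λ d → toℕ d < toℕ b) a≡c a<b

¬Peak-at-0 : ∀ {a c} → ¬ Peak a 0F c
¬Peak-at-0 (_ , ())

peak? : ∀ a b c → Dec (Peak a b c)
peak? a b c = (a ≟ c) ×-dec (toℕ a <? toℕ b)

PeakFree : ∀ {n} → Colour → Colour → Vec Colour n → Set
PeakFree a b []      = ⊤
PeakFree a b (c ∷ _) = ¬ Peak a b c

peakFree? : ∀ {n} a b (w : Vec Colour n) → Dec (PeakFree a b w)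
peakFree? a b []      = yes tt
peakFree? a b (c ∷ _) = ¬? (peak? a b c)

RsWord : ∀ {n} → Vec Colour n → Set
RsWord []          = ⊤
RsWord (a ∷ [])    = ⊤
RsWord (a ∷ b ∷ w) = a ≢ b × PeakFree a b w × RsWord (b ∷ w)

rsWord? : ∀ {n} (w : Vec Colour n) → Dec (RsWord w)
rsWord? []          = yes tt
rsWord? (a ∷ [])    = yes tt
rsWord? (a ∷ b ∷ w) = ¬? (a ≟ b) ×-dec peakFree? a b w ×-dec rsWord? (b ∷ w)

RsWord-tail : ∀ {n} a (w : Vec Colour n) → RsWord (a ∷ w) → RsWord w
RsWord-tail a []      _             = tt
RsWord-tail a (b ∷ w) (_ , _ , rs) = rs

RsWord-∷-0 : ∀ {n a} (w : Vec Colour n) → a ≢ 0F → RsWord (0F ∷ w) → RsWord (a ∷ 0F ∷ w)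
RsWord-∷-0 []      a≢0 rs = a≢0 , tt , tt
RsWord-∷-0 (_ ∷ _) a≢0 rs = a≢0 , ¬Peak-at-0 , rs

RsWord-120-∷ : ∀ {n} (w : Vec Colour n) → RsWord (0F ∷ w) → RsWord (0F ∷ 1F ∷ 2F ∷ 0F ∷ w)
RsWord-120-∷ w rs = (λ ()) , (λ ()) , (λ ()) , (λ ()) , RsWord-∷-0 w (λ ()) rs

data _⋖_ : ∀ {n} → Fin n → Fin n → Set where
  zero⋖ : ∀ {n} → zero {suc n} ⋖ suc zero
  suc⋖  : ∀ {n} {x y : Fin n} → x ⋖ y → suc x ⋖ suc y

⋖-from-toℕ : ∀ {n} {x y : Fin n} → suc (toℕ x) ≡ toℕ y → x ⋖ y
⋖-from-toℕ {x = zero}  {suc zero}    refl = zero⋖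
⋖-from-toℕ {x = suc x} {suc y}       e    = suc⋖ (⋖-from-toℕ (suc-injective e))
⋖-from-toℕ {x = zero}  {suc (suc _)} ()

RsWord-proper : ∀ {n} (w : Vec Colour n) → RsWord w →
  ∀ {x y} → x ⋖ y → lookup w x ≢ lookup w y
RsWord-proper (a ∷ b ∷ w) (a≢b , _) zero⋖   = a≢b
RsWord-proper (a ∷ w)     rs        (suc⋖ p) = RsWord-proper w (RsWord-tail a w rs) p

RsWord-peakFree : ∀ {n} (w : Vec Colour n) → RsWord w →
  ∀ {x y z} → x ⋖ y → y ⋖ z → ¬ Peak (lookup w x) (lookup w y) (lookup w z)
RsWord-peakFree (a ∷ b ∷ c ∷ w) (_ , noPeak , _) zero⋖ (suc⋖ zero⋖) = noPeak
RsWord-peakFree (a ∷ w) rs (suc⋖ p) (suc⋖ q) =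
  RsWord-peakFree w (RsWord-tail a w rs) p q

Path-3rs : ∀ {n} (f : Fin n → Colour) →
  (∀ {x y} → x ⋖ y → f x ≢ f y) →
  (∀ {x y z} → x ⋖ y → y ⋖ z → ¬ Peak (f x) (f y) (f z)) →
  Is3rsColouring (Path n) f
Path-3rs f proper peakFree = properPath , peakFreePath
  where
  properPath : ∀ x y → Adj (Path _) x y → f x ≢ f y
  properPath x y (inj₁ e) = proper (⋖-from-toℕ e)
  properPath x y (inj₂ e) fx≡fy = proper (⋖-from-toℕ e) (sym fx≡fy)

  peakFreePath : ∀ x y z → Adj (Path _) x y → Adj (Path _) y z → x ≢ z →
    f x ≡ f z → toℕ (f x) < toℕ (f y) → ⊥
  peakFreePath x y z (inj₁ e₁) (inj₁ e₂) _ fx≡fz lt =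
    peakFree (⋖-from-toℕ e₁) (⋖-from-toℕ e₂) (fx≡fz , lt)
  peakFreePath x y z (inj₂ e₁) (inj₂ e₂) _ fx≡fz lt =
    peakFree (⋖-from-toℕ e₂) (⋖-from-toℕ e₁) (Peak-sym (fx≡fz , lt))
  peakFreePath x y z (inj₁ e₁) (inj₂ e₂) x≢z _ _ =
    x≢z (toℕ-injective (suc-injective (trans e₁ (sym e₂))))
  peakFreePath x y z (inj₂ e₁) (inj₁ e₂) x≢z _ _ =
    x≢z (toℕ-injective (trans (sym e₁) e₂))

RsWord-3rs : ∀ {n} (w : Vec Colour n) → RsWord w → Is3rsColouring (Path n) (lookup w)
RsWord-3rs w rs = Path-3rs (lookup w) (RsWord-proper w rs) (RsWord-peakFree w rs)

zeroTail : (k : ℕ) → Fin 2 → Vec Colour (6 + k)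
zeroTail 0 0F = 1F ∷ 2F ∷ 0F ∷ 1F ∷ 2F ∷ 0F ∷ []
zeroTail 0 1F = 2F ∷ 1F ∷ 2F ∷ 0F ∷ 2F ∷ 1F ∷ []
zeroTail 1 0F = 1F ∷ 2F ∷ 0F ∷ 2F ∷ 1F ∷ 2F ∷ 0F ∷ []
zeroTail 1 1F = 1F ∷ 2F ∷ 0F ∷ 1F ∷ 2F ∷ 0F ∷ 1F ∷ []
zeroTail 2 0F = 2F ∷ 1F ∷ 2F ∷ 0F ∷ 2F ∷ 1F ∷ 2F ∷ 0F ∷ []
zeroTail 2 1F = 1F ∷ 2F ∷ 0F ∷ 1F ∷ 2F ∷ 0F ∷ 2F ∷ 1F ∷ []
zeroTail (suc (suc (suc k))) j = 1F ∷ 2F ∷ 0F ∷ zeroTail k j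

RsWord-0∷zeroTail : ∀ k j → RsWord (0F ∷ zeroTail k j)
RsWord-0∷zeroTail 0 0F = from-yes (rsWord? (0F ∷ zeroTail 0 0F))
RsWord-0∷zeroTail 0 1F = from-yes (rsWord? (0F ∷ zeroTail 0 1F))
RsWord-0∷zeroTail 1 0F = from-yes (rsWord? (0F ∷ zeroTail 1 0F))
RsWord-0∷zeroTail 1 1F = from-yes (rsWord? (0F ∷ zeroTail 1 1F))
RsWord-0∷zeroTail 2 0F = from-yes (rsWord? (0F ∷ zeroTail 2 0F))
RsWord-0∷zeroTail 2 1F = from-yes (rsWord? (0F ∷ zeroTail 2 1F))
RsWord-0∷zeroTail (suc (suc (suc k))) j = RsWord-120-∷ (zeroTail k j) (RsWord-0∷zeroTail k j)

zeroTail-last : ∀ k j → lookup (zeroTail k j) (fromℕ (5 + k)) ≡ inject₁ j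
zeroTail-last 0 0F = refl
zeroTail-last 0 1F = refl
zeroTail-last 1 0F = refl
zeroTail-last 1 1F = refl
zeroTail-last 2 0F = refl
zeroTail-last 2 1F = refl
zeroTail-last (suc (suc (suc k))) j = zeroTail-last k j

rsWord : (k : ℕ) → Fin 2 → Fin 2 → Vec Colour (7 + k)
rsWord k       0F j  = 0F ∷ zeroTail k j
rsWord (suc k) 1F j  = 1F ∷ 0F ∷ zeroTail k j
rsWord 0       1F 0F = 1F ∷ 2F ∷ 0F ∷ 2F ∷ 1F ∷ 2F ∷ 0F ∷ []
rsWord 0       1F 1F = 1F ∷ 0F ∷ 1F ∷ 2F ∷ 0F ∷ 2F ∷ 1F ∷ []

RsWord-rsWord : ∀ k i j → RsWord (rsWord k i j)
RsWord-rsWord k       0F j  = RsWord-0∷zeroTail k j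
RsWord-rsWord (suc k) 1F j  = RsWord-∷-0 (zeroTail k j) (λ ()) (RsWord-0∷zeroTail k j)
RsWord-rsWord 0       1F 0F = from-yes (rsWord? (rsWord 0 1F 0F))
RsWord-rsWord 0       1F 1F = from-yes (rsWord? (rsWord 0 1F 1F))

rsWord-first : ∀ k i j → lookup (rsWord k i j) zero ≡ inject₁ i
rsWord-first k       0F j  = refl
rsWord-first (suc k) 1F j  = refl
rsWord-first 0       1F 0F = refl
rsWord-first 0       1F 1F = refl

rsWord-last : ∀ k i j → lookup (rsWord k i j) (fromℕ (6 + k)) ≡ inject₁ j
rsWord-last k       0F j  = zeroTail-last k j
rsWord-last (suc k) 1F j  = zeroTail-last k j
rsWord-last 0       1F 0F = refl
rsWord-last 0       1F 1F = refl

lemma1 : (n : ℕ) → 7 ≤ n → (i j : Fin 2) →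
    Σ (Fin n → Fin 3) λ f →
      Is3rsColouring (Path n) f
      × (∀ (x : Fin n) → toℕ x ≡ 0 → f x ≡ inject₁ i)
      × (∀ (x : Fin n) → toℕ x ≡ n ∸ 1 → f x ≡ inject₁ j)
lemma1 n 7≤n i j with m≤n⇒∃[o]m+o≡n 7≤n
... | k , refl = lookup w , RsWord-3rs w (RsWord-rsWord k i j) , first , last
  where
  w : Vec Colour (7 + k)
  w = rsWord k i j

  first : ∀ x → toℕ x ≡ 0 → lookup w x ≡ inject₁ i
  first x x≡0 = trans (cong (lookup w) (toℕ-injective x≡0)) (rsWord-first k i j)

  last : ∀ x → toℕ x ≡ 6 + k → lookup w x ≡ inject₁ j
  last x x≡6+k = trans (cong (lookup w) (toℕ-injective (trans x≡6+k (sym (toℕ-fromℕ _)))))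
                       (rsWord-last k i j)
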